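{- There is a cograph $G$ such that $V(G)$ admits no partition into three (possibly empty) sets each of which is $1/3$-restricted.
   Context: All graphs are finite and simple; $G[X]$ is the induced subgraph on $X$, $\overline{G}$ the complement. A cograph is a graph with no induced subgraph isomorphic to $P_4$ (the path on four vertices). For $\varepsilon>0$, a set $X\subseteq V(G)$ is $\varepsilon$-restricted if one of $G[X]$, $\overline{G}[X]$ has maximum degree at most $\varepsilon|X|$. -}

module Defs where

open import Data.Nat using (ℕ; zero; suc; _+_; _*_; _≤_)
open import Data.Fin using (Fin; zero; suc; _≟_)
open import Data.Bool using (Bool; true; false; not; _∧_; if_then_else_)
open import Data.Product using (Σ; _×_)
open import Data.Sum using (_⊎_)
open import Relation.Nullary using (¬_; does)
open import Relation.Binary.PropositionalEquality using (_≡_)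
open import Function.Definitions using (Injective)

record Graph : Set where
  field
    n      : ℕ
    adj    : Fin n → Fin n → Bool
    sym    : ∀ u v → adj u v ≡ adj v u
    irrefl : ∀ v → adj v v ≡ false
open Graph public

compAdj : (G : Graph) → Fin (n G) → Fin (n G) → Bool
compAdj G u v = not (adj G u v) ∧ not (does (u ≟ v))

count : {m : ℕ} → (Fin m → Bool) → ℕ
count {zero}  f = 0
count {suc m} f = (if f zero then 1 else 0) + count (λ i → f (suc i))

VSet : Graph → Set
VSet G = Fin (n G) → Bool

size : (G : Graph) → VSet G → ℕ
size G X = count X

degIn : (G : Graph) → (Fin (n G) → Fin (n G) → Bool) → VSet G → Fin (n G) → ℕ
degIn G a X v = count (λ u → X u ∧ a v u)

-- maximum degree of the induced subgraph (adjacency a, vertex set X) is ≤ (p/q)|X|,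
-- written without division: q · deg(v) ≤ p · |X| for every v ∈ X.
MaxDegAtMostFrac : (G : Graph) → (Fin (n G) → Fin (n G) → Bool) → VSet G → ℕ → ℕ → Set
MaxDegAtMostFrac G a X p q = ∀ v → X v ≡ true → q * degIn G a X v ≤ p * size G X

Restricted : (G : Graph) → ℕ → ℕ → VSet G → Set
Restricted G p q X = MaxDegAtMostFrac G (adj G) X p q ⊎ MaxDegAtMostFrac G (compAdj G) X p q

P4adj : Fin 4 → Fin 4 → Bool
P4adj zero (suc zero) = true
P4adj (suc zero) zero = true
P4adj (suc zero) (suc (suc zero)) = true
P4adj (suc (suc zero)) (suc zero) = true
P4adj (suc (suc zero)) (suc (suc (suc zero))) = true
P4adj (suc (suc (suc zero))) (suc (suc zero)) = true
P4adj _ _ = false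

HasInducedP4 : Graph → Set
HasInducedP4 G = Σ (Fin 4 → Fin (n G)) λ f →
  Injective _≡_ _≡_ f × (∀ i j → adj G (f i) (f j) ≡ P4adj i j)

Cograph : Graph → Set
Cograph G = ¬ HasInducedP4 G

-- a partition of V(G) into three (possibly empty) parts: a 3-colouring c;
-- part k is {v | c v = k}
part : (G : Graph) → (Fin (n G) → Fin 3) → Fin 3 → VSet G
part G c k v = does (c v ≟ k)

-- Take the join of an independent set I with the disjoint union of cliques A, B, C, where
-- |I| = 13, |A| = 9, |B| = 5, |C| = 1. Joins and disjoint unions preserve P4-freeness, so this
-- is a cograph. Its vertices fall into four blocks, within which all vertices are twins, so
-- whether a set X is 1/3-restricted depends only on how many vertices X takes from each block.
-- It therefore suffices to check every way of splitting the block sizes (13, 9, 5, 1) into three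
-- count vectors, and in none of them are all three parts 1/3-restricted.
{-# OPTIONS --safe #-}
module Submission where

open import Defs hiding (sym)
open import Data.Bool.Base using (Bool; true; false; not; _∧_; _∨_; if_then_else_)
open import Data.Bool.Properties using (∧-identityʳ; ∧-zeroʳ; ∧-comm; ∧-conicalˡ; ∧-conicalʳ)
  renaming (_≟_ to _≟ᵇ_)
open import Data.Fin.Base using (Fin; zero; suc; toℕ)
open import Data.Fin.Patterns using (0F; 1F; 2F; 3F)
open import Data.Fin.Properties using (_≟_; all?; suc-injective)
open import Data.Nat.Base using (ℕ; zero; suc; _+_; _*_; _∸_; _≤_; _<_; _<ᵇ_; z≤n; s≤s)
open import Data.Nat.Properties
  using (+-0-commutativeMonoid; +-comm; +-assoc; +-identityʳ; *-distribˡ-+; +-monoˡ-≤;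
         m≤m+n; m+n∸m≡n; _≤?_; _<?_; module ≤-Reasoning)
open import Algebra.Properties.CommutativeMonoid.Sum +-0-commutativeMonoid
  using (sum-syntax; sum-cong-≗; ∑-distrib-+; sum-replicate-zero)
open import Data.Product.Base using (Σ; ∃-syntax; _×_; _,_)
open import Data.Sum.Base using (_⊎_; inj₁; inj₂)
open import Data.Vec.Base using (Vec; []; _∷_; lookup; tabulate; zipWith)
open import Data.Vec.Properties using (lookup∘tabulate; lookup-zipWith)
open import Function.Base using (_∘_)
open import Relation.Binary.PropositionalEquality
  using (_≡_; _≢_; _≗_; refl; sym; trans; cong; cong₂; subst; module ≡-Reasoning)
open import Relation.Nullary.Decidable
  using (Dec; yes; no; does; ¬?; _×-dec_; _⊎-dec_; _→-dec_; dec-true; dec-false; from-yes)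
open import Relation.Nullary.Negation using (¬_)

[_] : Bool → ℕ
[ b ] = if b then 1 else 0

∑-cong : ∀ {k} {f g : Fin k → ℕ} → f ≗ g → ∑[ j < k ] f j ≡ ∑[ j < k ] g j
∑-cong {f = f} {g} = sum-cong-≗ {x = f} {y = g}

count-cong : ∀ {m} {f g : Fin m → Bool} → f ≗ g → count f ≡ count g
count-cong {zero}  f≗g = refl
count-cong {suc m} f≗g = cong₂ _+_ (cong [_] (f≗g zero)) (count-cong (f≗g ∘ suc))

count-false : ∀ m → count {m} (λ _ → false) ≡ 0
count-false zero    = refl
count-false (suc m) = count-false m

count-∧ʳ : ∀ {m} (f : Fin m → Bool) b → count (λ u → f u ∧ b) ≡ (if b then count f else 0)
count-∧ʳ     f true  = count-cong (λ u → ∧-identityʳ (f u))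
count-∧ʳ {m} f false = trans (count-cong (λ u → ∧-zeroʳ (f u))) (count-false m)

count-witness : ∀ {m} (f : Fin m → Bool) → 0 < count f → ∃[ u ] f u ≡ true
count-witness {suc m} f pos with f zero in eq
... | true  = zero , eq
... | false with count-witness (f ∘ suc) pos
...   | u , fu = suc u , fu

count-differ-at : ∀ {m} {f g : Fin m → Bool} v → (∀ u → u ≢ v → f u ≡ g u) → f v ≡ false →
                  count f + [ g v ] ≡ count g
count-differ-at {suc m} {f} {g} zero agree fv = begin
  [ f zero ] + count (f ∘ suc) + [ g zero ]
    ≡⟨ cong (λ b → [ b ] + count (f ∘ suc) + [ g zero ]) fv ⟩
  count (f ∘ suc) + [ g zero ]
    ≡⟨ +-comm (count (f ∘ suc)) [ g zero ] ⟩
  [ g zero ] + count (f ∘ suc)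
    ≡⟨ cong ([ g zero ] +_) (count-cong (λ u → agree (suc u) λ ())) ⟩
  [ g zero ] + count (g ∘ suc)
    ∎
  where open ≡-Reasoning
count-differ-at {suc m} {f} {g} (suc v) agree fv = begin
  [ f zero ] + count (f ∘ suc) + [ g (suc v) ]
    ≡⟨ +-assoc [ f zero ] _ _ ⟩
  [ f zero ] + (count (f ∘ suc) + [ g (suc v) ])
    ≡⟨ cong₂ _+_ (cong [_] (agree zero λ ()))
                 (count-differ-at v (λ u u≢v → agree (suc u) (u≢v ∘ suc-injective)) fv) ⟩
  [ g zero ] + count (g ∘ suc)
    ∎
  where open ≡-Reasoning

indicator-sum : ∀ {k} (i : Fin k) b → ∑[ j < k ] [ does (i ≟ j) ∧ b ] ≡ [ b ]
indicator-sum {suc k} zero    b = trans (cong ([ b ] +_) (sum-replicate-zero k)) (+-identityʳ [ b ])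
indicator-sum {suc k} (suc i) b = indicator-sum i b

count-partition : ∀ {m k} (c : Fin m → Fin k) (f : Fin m → Bool) →
                  count f ≡ ∑[ j < k ] count (λ u → does (c u ≟ j) ∧ f u)
count-partition {zero}  {k} c f = sym (sum-replicate-zero k)
count-partition {suc m} {k} c f = begin
  [ f zero ] + count (f ∘ suc)
    ≡⟨ cong₂ _+_ (sym (indicator-sum (c zero) (f zero))) (count-partition (c ∘ suc) (f ∘ suc)) ⟩
  ∑[ j < k ] [ does (c zero ≟ j) ∧ f zero ] + ∑[ j < k ] count (λ u → does (c (suc u) ≟ j) ∧ f (suc u))
    ≡⟨ sym (∑-distrib-+ (λ j → [ does (c zero ≟ j) ∧ f zero ]) _) ⟩
  ∑[ j < k ] count (λ u → does (c u ≟ j) ∧ f u)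
    ∎
  where open ≡-Reasoning

does-≟-sym : ∀ {k} (i j : Fin k) → does (i ≟ j) ≡ does (j ≟ i)
does-≟-sym i j with i ≟ j
... | yes refl = sym (dec-true (i ≟ i) refl)
... | no  i≢j  = sym (dec-false (j ≟ i) (i≢j ∘ sym))

does-≟-∧-subst : ∀ {k} (i j : Fin k) b (t : Fin k → Bool) →
                 does (i ≟ j) ∧ (b ∧ t i) ≡ (does (i ≟ j) ∧ b) ∧ t j
does-≟-∧-subst i j b t with i ≟ j
... | yes refl = refl
... | no  _    = refl

-- For a vertex v ∈ X in block β this counts v itself when β is a clique block, so it equals the
-- degree of v in G[X] plus [ T β β ]; BlockBounded adds q * [ T β β ] instead of subtracting it.
neighbourCount : ∀ {k} → (Fin k → Fin k → Bool) → Vec ℕ k → Fin k → ℕ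
neighbourCount {k} T x β = ∑[ j < k ] (if T β j then lookup x j else 0)

BlockBounded : ∀ {k} → (Fin k → Fin k → Bool) → ℕ → ℕ → Vec ℕ k → Set
BlockBounded {k} T p q x = ∀ β → 0 < lookup x β →
  q * neighbourCount T x β ≤ p * ∑[ j < k ] lookup x j + q * [ T β β ]

blockBounded? : ∀ {k} T p q (x : Vec ℕ k) → Dec (BlockBounded T p q x)
blockBounded? T p q x = all? λ β → (0 <? lookup x β) →-dec (_ ≤? _)

RestrictedCounts : ∀ {k} → (Fin k → Fin k → Bool) → ℕ → ℕ → Vec ℕ k → Set
RestrictedCounts T p q x = BlockBounded T p q x ⊎ BlockBounded (λ i j → not (T i j)) p q x

restrictedCounts? : ∀ {k} T p q (x : Vec ℕ k) → Dec (RestrictedCounts T p q x)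
restrictedCounts? T p q x = blockBounded? T p q x ⊎-dec blockBounded? (λ i j → not (T i j)) p q x

module Blocks {m k} (blk : Fin m → Fin k) where

  blockCount : (Fin m → Bool) → Fin k → ℕ
  blockCount X j = count (λ u → does (blk u ≟ j) ∧ X u)

  counts : (Fin m → Bool) → Vec ℕ k
  counts X = tabulate (blockCount X)

  lookup-counts : ∀ X j → lookup (counts X) j ≡ blockCount X j
  lookup-counts X = lookup∘tabulate (blockCount X)

  count≡∑counts : ∀ X → count X ≡ ∑[ j < k ] lookup (counts X) j
  count≡∑counts X = trans (count-partition blk X) (∑-cong (λ j → sym (lookup-counts X j)))

  counts-parts : ∀ {r} (c : Fin m → Fin r) j →
                 ∑[ i < r ] lookup (counts (λ u → does (c u ≟ i))) j ≡ lookup (counts (λ _ → true)) j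
  counts-parts {r} c j = begin
    ∑[ i < r ] lookup (counts (λ u → does (c u ≟ i))) j
      ≡⟨ ∑-cong (λ i → trans (lookup-counts (λ u → does (c u ≟ i)) j)
                             (count-cong (λ u → ∧-comm (does (blk u ≟ j)) _))) ⟩
    ∑[ i < r ] count (λ u → does (c u ≟ i) ∧ does (blk u ≟ j))
      ≡⟨ sym (count-partition c _) ⟩
    count (λ u → does (blk u ≟ j))
      ≡⟨ sym (trans (lookup-counts (λ _ → true) j)
                    (count-cong (λ u → ∧-identityʳ (does (blk u ≟ j))))) ⟩
    lookup (counts (λ _ → true)) j
      ∎
    where open ≡-Reasoning

  degree-by-blocks : ∀ {a : Fin m → Fin m → Bool} {S : Fin k → Fin k → Bool} {X v} →
                     (∀ u → u ≢ v → a v u ≡ S (blk v) (blk u)) → a v v ≡ false → X v ≡ true →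
                     count (λ u → X u ∧ a v u) + [ S (blk v) (blk v) ] ≡
                     neighbourCount S (counts X) (blk v)
  degree-by-blocks {a} {S} {X} {v} agree irr Xv = begin
    count (λ u → X u ∧ a v u) + [ S β β ]
      ≡⟨ cong (λ b → count (λ u → X u ∧ a v u) + [ b ∧ S β β ]) (sym Xv) ⟩
    count (λ u → X u ∧ a v u) + [ X v ∧ S β (blk v) ]
      ≡⟨ count-differ-at v (λ u u≢v → cong (X u ∧_) (agree u u≢v))
                           (trans (cong (X v ∧_) irr) (∧-zeroʳ _)) ⟩
    count (λ u → X u ∧ S β (blk u))
      ≡⟨ count-partition blk _ ⟩
    ∑[ j < k ] count (λ u → does (blk u ≟ j) ∧ (X u ∧ S β (blk u)))
      ≡⟨ ∑-cong (λ j → trans (count-cong (λ u → does-≟-∧-subst (blk u) j (X u) (S β)))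
                             (count-∧ʳ (λ u → does (blk u ≟ j) ∧ X u) (S β j))) ⟩
    ∑[ j < k ] (if S β j then blockCount X j else 0)
      ≡⟨ ∑-cong (λ j → cong (if S β j then_else 0) (sym (lookup-counts X j))) ⟩
    neighbourCount S (counts X) β
      ∎
    where
    open ≡-Reasoning
    β : Fin k
    β = blk v

-- Vertices of an induced P4 may share a block, so the pattern need not be injective.
P4Free : ∀ {k} → (Fin k → Fin k → Bool) → Set
P4Free T = ∀ a b c d → ¬ (T a b ≡ true × T b c ≡ true × T c d ≡ true ×
                          T a c ≡ false × T b d ≡ false × T a d ≡ false)

p4Free? : ∀ {k} (T : Fin k → Fin k → Bool) → Dec (P4Free T)
p4Free? T = all? λ a → all? λ b → all? λ c → all? λ d →
  ¬? ((T a b ≟ᵇ true) ×-dec (T b c ≟ᵇ true) ×-dec (T c d ≟ᵇ true) ×-dec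
      (T a c ≟ᵇ false) ×-dec (T b d ≟ᵇ false) ×-dec (T a d ≟ᵇ false))

-- A symmetric T : Fin k → Fin k → Bool is a graph with loops on the blocks; a loop makes the
-- block a clique, its absence an independent set.
blowUp : ∀ {k m} (T : Fin k → Fin k → Bool) → (∀ i j → T i j ≡ T j i) → (Fin m → Fin k) → Graph
blowUp {m = m} T T-sym blk = record
  { n      = m
  ; adj    = λ u v → T (blk u) (blk v) ∧ not (does (u ≟ v))
  ; sym    = λ u v → cong₂ (λ t e → t ∧ not e) (T-sym (blk u) (blk v)) (does-≟-sym u v)
  ; irrefl = λ v → trans (cong (λ e → T (blk v) (blk v) ∧ not e) (dec-true (v ≟ v) refl)) (∧-zeroʳ _)
  }

module BlowUp {k} (T : Fin k → Fin k → Bool) (T-sym : ∀ i j → T i j ≡ T j i)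
              {m} (blk : Fin m → Fin k) where

  open Blocks blk

  private
    G : Graph
    G = blowUp T T-sym blk

  adj-distinct : ∀ {u v} → u ≢ v → adj G u v ≡ T (blk u) (blk v)
  adj-distinct {u} {v} u≢v =
    trans (cong (λ e → T (blk u) (blk v) ∧ not e) (dec-false (u ≟ v) u≢v)) (∧-identityʳ _)

  compAdj-distinct : ∀ {u v} → u ≢ v → compAdj G u v ≡ not (T (blk u) (blk v))
  compAdj-distinct {u} {v} u≢v =
    trans (cong₂ (λ a e → not a ∧ not e) (adj-distinct u≢v) (dec-false (u ≟ v) u≢v)) (∧-identityʳ _)

  compAdj-irrefl : ∀ v → compAdj G v v ≡ false
  compAdj-irrefl v = trans (cong (λ e → not (adj G v v) ∧ not e) (dec-true (v ≟ v) refl)) (∧-zeroʳ _)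

  maxDeg⇒blockBounded : ∀ {a : Fin m → Fin m → Bool} {S : Fin k → Fin k → Bool} →
                        (∀ {u v} → u ≢ v → a u v ≡ S (blk u) (blk v)) → (∀ v → a v v ≡ false) →
                        ∀ {p q} X → MaxDegAtMostFrac G a X p q → BlockBounded S p q (counts X)
  maxDeg⇒blockBounded {a} {S} det irr {p} {q} X bound β nonempty
    with count-witness _ (subst (0 <_) (lookup-counts X β) nonempty)
  ... | v , inβ∩X with blk v ≟ β | inβ∩X
  ...   | yes refl | Xv = begin
    q * neighbourCount S (counts X) β
      ≡⟨ cong (q *_) (sym (degree-by-blocks {a} {S} (λ u u≢v → det (u≢v ∘ sym)) (irr v) Xv)) ⟩
    q * (degIn G a X v + [ S β β ])
      ≡⟨ *-distribˡ-+ q _ _ ⟩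
    q * degIn G a X v + q * [ S β β ]
      ≤⟨ +-monoˡ-≤ _ (bound v Xv) ⟩
    p * count X + q * [ S β β ]
      ≡⟨ cong (λ s → p * s + q * [ S β β ]) (count≡∑counts X) ⟩
    p * ∑[ j < k ] lookup (counts X) j + q * [ S β β ]
      ∎
    where open ≤-Reasoning

  restricted⇒restrictedCounts : ∀ {p q} X → Restricted G p q X → RestrictedCounts T p q (counts X)
  restricted⇒restrictedCounts {p} {q} X (inj₁ bound) =
    inj₁ (maxDeg⇒blockBounded {S = T} adj-distinct (irrefl G) {p} {q} X bound)
  restricted⇒restrictedCounts {p} {q} X (inj₂ bound) =
    inj₂ (maxDeg⇒blockBounded {S = λ i j → not (T i j)} compAdj-distinct compAdj-irrefl
                              {p} {q} X bound)

  blowUp-cograph : P4Free T → Cograph G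
  blowUp-cograph p4Free (f , inj , induced) =
    p4Free _ _ _ _ (edge 0F 1F (λ ()) , edge 1F 2F (λ ()) , edge 2F 3F (λ ()) ,
                    edge 0F 2F (λ ()) , edge 1F 3F (λ ()) , edge 0F 3F (λ ()))
    where
    edge : ∀ i j → i ≢ j → T (blk (f i)) (blk (f j)) ≡ P4adj i j
    edge i j i≢j = trans (sym (adj-distinct (i≢j ∘ inj))) (induced i j)

allUpTo : ℕ → (ℕ → Bool) → Bool
allUpTo zero    p = p zero
allUpTo (suc n) p = p zero ∧ allUpTo n (p ∘ suc)

allUpTo-sound : ∀ {n m} p → allUpTo n p ≡ true → m ≤ n → p m ≡ true
allUpTo-sound {zero}          p all z≤n       = all
allUpTo-sound {suc n} {zero}  p all _         = ∧-conicalˡ _ _ all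
allUpTo-sound {suc n} {suc m} p all (s≤s m≤n) = allUpTo-sound (p ∘ suc) (∧-conicalʳ _ _ all) m≤n

allSplits : ∀ {k} → Vec ℕ k → (Vec ℕ k → Vec ℕ k → Bool) → Bool
allSplits []       p = p [] []
allSplits (n ∷ ns) p = allUpTo n λ i → allSplits ns λ xs ys → p (i ∷ xs) (n ∸ i ∷ ys)

allSplits-sound : ∀ {k} {n x y : Vec ℕ k} p → allSplits n p ≡ true →
                  (∀ i → lookup x i + lookup y i ≡ lookup n i) → p x y ≡ true
allSplits-sound {n = []}     {[]}     {[]}     p all sums = all
allSplits-sound {n = n ∷ ns} {x ∷ xs} {y ∷ ys} p all sums =
  subst (λ z → p (x ∷ xs) (z ∷ ys) ≡ true) n∸x≡y
        (allSplits-sound {n = ns} {xs} {ys} _ (allUpTo-sound _ all x≤n) (sums ∘ suc))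
  where
  x≤n : x ≤ n
  x≤n = subst (x ≤_) (sums zero) (m≤m+n x y)
  n∸x≡y : n ∸ x ≡ y
  n∸x≡y = trans (cong (_∸ x) (sym (sums zero))) (m+n∸m≡n x y)

noThreeSplitsᵇ : ∀ {k} {P : Vec ℕ k → Set} → (∀ x → Dec (P x)) → Vec ℕ k → Bool
noThreeSplitsᵇ P? n =
  allSplits n λ x r → not (does (P? x)) ∨ allSplits r λ y z → not (does (P? y) ∧ does (P? z))

noThreeSplits-sound : ∀ {k} {P : Vec ℕ k → Set} (P? : ∀ x → Dec (P x)) n →
                      noThreeSplitsᵇ P? n ≡ true →
                      (xs : Fin 3 → Vec ℕ k) → (∀ i → ∑[ j < 3 ] lookup (xs j) i ≡ lookup n i) →
                      ¬ (∀ j → P (xs j))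
noThreeSplits-sound P? n check xs sums Pxs =
  false≢true (trans (sym (cong₂ (λ a b → not (a ∧ b)) (holds 1F) (holds 2F))) notBoth)
  where
  false≢true : false ≢ true
  false≢true ()
  rest : Vec _ _
  rest = zipWith _+_ (xs 1F) (xs 2F)
  sums₀ : ∀ i → lookup (xs 0F) i + lookup rest i ≡ lookup n i
  sums₀ i = begin
    lookup (xs 0F) i + lookup rest i
      ≡⟨ cong (lookup (xs 0F) i +_) (lookup-zipWith _+_ i (xs 1F) (xs 2F)) ⟩
    lookup (xs 0F) i + (lookup (xs 1F) i + lookup (xs 2F) i)
      ≡⟨ cong (λ t → lookup (xs 0F) i + (lookup (xs 1F) i + t)) (sym (+-identityʳ _)) ⟩
    ∑[ j < 3 ] lookup (xs j) i
      ≡⟨ sums i ⟩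
    lookup n i
      ∎
    where open ≡-Reasoning
  holds : ∀ j → does (P? (xs j)) ≡ true
  holds j = dec-true (P? (xs j)) (Pxs j)
  notBothᵇ : Vec _ _ → Vec _ _ → Bool
  notBothᵇ y z = not (does (P? y) ∧ does (P? z))
  splitsRest : allSplits rest notBothᵇ ≡ true
  splitsRest = subst (λ b → not b ∨ allSplits rest notBothᵇ ≡ true) (holds 0F)
                     (allSplits-sound {n = n} {xs 0F} {rest} _ check sums₀)
  notBoth : not (does (P? (xs 1F)) ∧ does (P? (xs 2F))) ≡ true
  notBoth = allSplits-sound {n = rest} {xs 1F} {xs 2F} _ splitsRest
                            (λ i → sym (lookup-zipWith _+_ i (xs 1F) (xs 2F)))

blockAdj : Fin 4 → Fin 4 → Bool
blockAdj zero    zero    = false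
blockAdj zero    (suc _) = true
blockAdj (suc _) zero    = true
blockAdj (suc i) (suc j) = does (i ≟ j)

blockAdj-sym : ∀ i j → blockAdj i j ≡ blockAdj j i
blockAdj-sym zero    zero    = refl
blockAdj-sym zero    (suc _) = refl
blockAdj-sym (suc _) zero    = refl
blockAdj-sym (suc i) (suc j) = does-≟-sym i j

block : Fin 28 → Fin 4
block u = if toℕ u <ᵇ 13 then 0F else if toℕ u <ᵇ 22 then 1F else if toℕ u <ᵇ 27 then 2F else 3F

open Blocks block using (counts; counts-parts)
open BlowUp blockAdj blockAdj-sym block using (blowUp-cograph; restricted⇒restrictedCounts)

blockSizes : counts (λ _ → true) ≡ 13 ∷ 9 ∷ 5 ∷ 1 ∷ []
blockSizes = refl

noRestrictedThreeSplit : (xs : Fin 3 → Vec ℕ 4) →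
                         (∀ i → ∑[ j < 3 ] lookup (xs j) i ≡ lookup (13 ∷ 9 ∷ 5 ∷ 1 ∷ []) i) →
                         ¬ (∀ j → RestrictedCounts blockAdj 1 3 (xs j))
noRestrictedThreeSplit = noThreeSplits-sound (restrictedCounts? blockAdj 1 3) (13 ∷ 9 ∷ 5 ∷ 1 ∷ []) refl

mainTheorem15 : Σ Graph λ G → Cograph G ×
    ((c : Fin (n G) → Fin 3) → ¬ (∀ k → Restricted G 1 3 (part G c k)))
mainTheorem15 = G , blowUp-cograph (from-yes (p4Free? blockAdj)) ,
  λ c restricted → noRestrictedThreeSplit (λ j → counts (part G c j))
    (λ i → trans (counts-parts c i) (cong (λ s → lookup s i) blockSizes))
    (λ j → restricted⇒restrictedCounts {1} {3} (part G c j) (restricted j))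
  where
  G : Graph
  G = blowUp blockAdj blockAdj-sym block
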